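{- Let $G=(V,E)$ be an undirected graph with $V=\{0,1,\dots,n-1\}$ and $E$ a symmetric set of ordered pairs. Run the iterative algorithm described in the context starting from $f=\mathrm{id}$. Suppose that in some iteration, producing $f_{\mathit{next}}$ from $f$, the grandparent vector is unchanged, i.e. $f_{\mathit{next}}[f_{\mathit{next}}[u]] = f[f[u]]$ for all $u\in V$. Then after that iteration every vertex points to a root, i.e. $f_{\mathit{next}}[f_{\mathit{next}}[u]]=f_{\mathit{next}}[u]$ for all $u\in V$.
   Context: The algorithm maintains a parent vector $f:V\to V$, initialized by $f[u]=u$ for all $u$; a vertex $r$ is a root if $f[r]=r$. One iteration maps the current vector $f$ to a new vector $f_{\mathit{next}}$ as follows. Start with $f_{\mathit{next}}=f$. (1) For every $(u,v)\in E$, set $f_{\mathit{next}}[f[u]]\leftarrow \min(f_{\mathit{next}}[f[u]],\, f[f[v]])$. (2) For every $(u,v)\in E$, set $f_{\mathit{next}}[u]\leftarrow\min(f_{\mathit{next}}[u],\, f[f[v]])$. (3) For every $u\in V$, set $f_{\mathit{next}}[u]\leftarrow\min(f_{\mathit{next}}[u],\, f[f[u]])$. All right-hand sides read the old vector $f$. Then $f$ is replaced by $f_{\mathit{next}}$ and the next iteration begins. -}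

module Defs where

open import Data.Nat using (ℕ; zero; suc)
open import Data.Fin using (Fin; toℕ)
open import Data.Fin.Properties using (_≟_)
open import Data.Nat using (_≤?_)
open import Data.Product using (_×_; _,_)
open import Data.List using (List; foldl)
open import Data.Bool using (if_then_else_)
open import Relation.Nullary.Decidable using (⌊_⌋)

minF : ∀ {n} → Fin n → Fin n → Fin n
minF a b = if ⌊ toℕ a ≤? toℕ b ⌋ then a else b

PV : ℕ → Set
PV n = Fin n → Fin n

updMin : ∀ {n} → PV n → Fin n → Fin n → PV n
updMin g x val y = if ⌊ y ≟ x ⌋ then minF (g y) val else g y

step1 : ∀ {n} → PV n → List (Fin n × Fin n) → PV n → PV n
step1 f E g = foldl (λ h e → updMin h (f (Data.Product.proj₁ e)) (f (f (Data.Product.proj₂ e)))) g E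

step2 : ∀ {n} → PV n → List (Fin n × Fin n) → PV n → PV n
step2 f E g = foldl (λ h e → updMin h (Data.Product.proj₁ e) (f (f (Data.Product.proj₂ e)))) g E

step3 : ∀ {n} → PV n → PV n → PV n
step3 f g u = minF (g u) (f (f u))

-- one iteration, starting from fnext = f, all right-hand sides read old f
iter : ∀ {n} → List (Fin n × Fin n) → PV n → PV n
iter E f = step3 f (step2 f E (step1 f E f))

run : ∀ {n} → List (Fin n × Fin n) → ℕ → PV n
run E zero = λ u → u
run E (suc k) = iter E (run E k)

-- Every step of an iteration only lowers entries, so run E k u ≤ u for all k, and the final
-- min with f[f[u]] gives f_next[u] ≤ f[f[u]]. If the grandparent vector is unchanged, then
-- f_next[u] ≤ f[f[u]] = f_next[f_next[u]] ≤ f_next[u].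
module Submission where

open import Defs
open import Data.Nat using (ℕ; zero; suc; _≤_; _≤?_)
open import Data.Nat.Properties using (≤-refl; ≤-reflexive; ≤-trans; ≤-antisym; ≰⇒≥)
open import Data.Fin using (Fin; toℕ)
open import Data.Fin.Properties using (toℕ-injective; _≟_)
open import Data.Product using (_×_; _,_)
open import Data.List using (List; []; _∷_; foldl)
open import Data.List.Membership.Propositional using (_∈_)
open import Relation.Binary.PropositionalEquality using (_≡_; sym; cong)
open import Relation.Nullary using (yes; no)

infix 4 _≤ᵥ_

_≤ᵥ_ : ∀ {n} → PV n → PV n → Set
g ≤ᵥ h = ∀ y → toℕ (g y) ≤ toℕ (h y)

≤ᵥ-refl : ∀ {n} {g : PV n} → g ≤ᵥ g
≤ᵥ-refl y = ≤-refl

≤ᵥ-trans : ∀ {n} {f g h : PV n} → f ≤ᵥ g → g ≤ᵥ h → f ≤ᵥ h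
≤ᵥ-trans p q y = ≤-trans (p y) (q y)

minF-≤ˡ : ∀ {n} (a b : Fin n) → toℕ (minF a b) ≤ toℕ a
minF-≤ˡ a b with toℕ a ≤? toℕ b
... | yes _   = ≤-refl
... | no  a≰b = ≰⇒≥ a≰b

minF-≤ʳ : ∀ {n} (a b : Fin n) → toℕ (minF a b) ≤ toℕ b
minF-≤ʳ a b with toℕ a ≤? toℕ b
... | yes a≤b = a≤b
... | no  _   = ≤-refl

updMin-≤ᵥ : ∀ {n} (g : PV n) x val → updMin g x val ≤ᵥ g
updMin-≤ᵥ g x val y with y ≟ x
... | yes _ = minF-≤ˡ (g y) val
... | no  _ = ≤-refl

foldl-≤ᵥ : ∀ {n} {A : Set} (step : PV n → A → PV n) →
           (∀ h a → step h a ≤ᵥ h) →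
           ∀ (xs : List A) g → foldl step g xs ≤ᵥ g
foldl-≤ᵥ step step≤ []       g = ≤ᵥ-refl
foldl-≤ᵥ step step≤ (a ∷ xs) g = ≤ᵥ-trans (foldl-≤ᵥ step step≤ xs (step g a)) (step≤ g a)

step1-≤ᵥ : ∀ {n} (f : PV n) E g → step1 f E g ≤ᵥ g
step1-≤ᵥ f E = foldl-≤ᵥ _ (λ h _ → updMin-≤ᵥ h _ _) E

step2-≤ᵥ : ∀ {n} (f : PV n) E g → step2 f E g ≤ᵥ g
step2-≤ᵥ f E = foldl-≤ᵥ _ (λ h _ → updMin-≤ᵥ h _ _) E

step3-≤ᵥ : ∀ {n} (f g : PV n) → step3 f g ≤ᵥ g
step3-≤ᵥ f g u = minF-≤ˡ (g u) (f (f u))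

step3-≤ᵥ-grandparent : ∀ {n} (f g : PV n) → step3 f g ≤ᵥ (λ u → f (f u))
step3-≤ᵥ-grandparent f g u = minF-≤ʳ (g u) (f (f u))

iter-≤ᵥ : ∀ {n} E (f : PV n) → iter E f ≤ᵥ f
iter-≤ᵥ E f = ≤ᵥ-trans (step3-≤ᵥ f _) (≤ᵥ-trans (step2-≤ᵥ f E _) (step1-≤ᵥ f E f))

iter-≤ᵥ-grandparent : ∀ {n} E (f : PV n) → iter E f ≤ᵥ (λ u → f (f u))
iter-≤ᵥ-grandparent E f = step3-≤ᵥ-grandparent f (step2 f E (step1 f E f))

run-≤ᵥ-id : ∀ {n} E k → run {n} E k ≤ᵥ (λ u → u)
run-≤ᵥ-id E zero    = ≤ᵥ-refl
run-≤ᵥ-id E (suc k) = ≤ᵥ-trans (iter-≤ᵥ E (run E k)) (run-≤ᵥ-id E k)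

lemma4 : (n : ℕ) (E : List (Fin n × Fin n)) →
           (∀ u v → (u , v) ∈ E → (v , u) ∈ E) →
           (k : ℕ) →
           (∀ u → run E (suc k) (run E (suc k) u) ≡ run E k (run E k u)) →
           ∀ u → run E (suc k) (run E (suc k) u) ≡ run E (suc k) u
lemma4 n E _ k grandparents-unchanged u = toℕ-injective (≤-antisym fnext²≤fnext fnext≤fnext²)
  where
    fnext f : PV n
    fnext = run E (suc k)
    f     = run E k

    fnext²≤fnext : toℕ (fnext (fnext u)) ≤ toℕ (fnext u)
    fnext²≤fnext = run-≤ᵥ-id E (suc k) (fnext u)

    fnext≤fnext² : toℕ (fnext u) ≤ toℕ (fnext (fnext u))
    fnext≤fnext² = ≤-trans (iter-≤ᵥ-grandparent E f u)
                           (≤-reflexive (cong toℕ (sym (grandparents-unchanged u))))
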